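{- The relation $\le$ on $\mathcal{F}_{\mathrm{ord}}(n)$ is a partial order, and $\lessdot$ is exactly its covering relation.
   Context: An ordered forest is a forest of rooted trees in which the children of each vertex are linearly ordered (left to right) and the trees are linearly ordered (left to right); $\mathcal{F}_{\mathrm{ord}}(n)$ is the set of ordered forests on $n$ vertices up to isomorphism of ordered forests. The (left-to-right) preorder traversal labels the vertices $1,\dots,n$: the root of the leftmost tree gets $1$; after labeling a non-leaf vertex, its leftmost child gets the next label; after labeling a leaf, the leftmost unlabeled child of the most recently labeled vertex that still has unlabeled children gets the next label; when a tree is fully labeled, the root of the next tree to the right gets the next label. Vertices are identified with these labels. The operation on a vertex $v$ of a forest $F$ produces $F[v]$: if $v$ is a leaf, $F[v]=F$; otherwise let $v'$ be the rightmost child of $v$: if $v$ has a parent $w$, delete the edge $v\to v'$ and make $v'$ a child of $w$ placed immediately to the right of $v$; if $v$ is a root, delete the edge $v\to v'$ and make the tree rooted at $v'$ (with its descendants) a new tree placed immediately to the right of the tree containing $v$. Define $F'\lessdot F$ if $F'$ is obtained from $F$ by operating on one non-leaf vertex of $F$, and $F'\le F$ if there is a finite sequence $F'=F_1,\dots,F_k=F$ ($k\ge1$) in $\mathcal{F}_{\mathrm{ord}}(n)$ with $F_i\lessdot F_{i+1}$ for all $i$. -}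

module Defs where

open import Data.Nat using (ℕ; zero; suc; _+_; _∸_; _≤_; _<ᵇ_)
open import Data.Bool using (if_then_else_)
open import Data.List using (List; []; _∷_)
open import Data.Maybe using (Maybe; just; nothing)
open import Data.Product using (Σ; _×_; _,_; proj₁; ∃)
open import Relation.Binary.PropositionalEquality using (_≡_; _≢_; refl)
open import Relation.Nullary using (¬_)
open import Relation.Binary.Construct.Closure.ReflexiveTransitive using (Star)

-- Syntactic equality of these terms is exactly
-- isomorphism of ordered trees, so isomorphism classes need no quotient.
data Tree : Set where
  node : List Tree → Tree

Forest : Set
Forest = List Tree

mutual
  sizeT : Tree → ℕ
  sizeT (node cs) = suc (sizeF cs)

  sizeF : Forest → ℕ
  sizeF [] = 0
  sizeF (t ∷ ts) = sizeT t + sizeF ts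

FOrd : ℕ → Set
FOrd n = Σ Forest (λ F → sizeF F ≡ n)

unsnoc : List Tree → Maybe (List Tree × Tree)
unsnoc [] = nothing
unsnoc (c ∷ cs) with unsnoc cs
... | nothing = just ([] , c)
... | just (cs' , l) = just (c ∷ cs' , l)

-- Vertices are addressed by 0-based preorder index k within a sibling list
-- (the paper's label is k + 1).  Operating on the vertex t = node cs with
-- cs = cs' ++ [v'] inside a sibling list replaces t by node cs' followed
-- immediately by v' (with its descendants).  For an inner vertex the sibling
-- list is the child list of its parent w; for a root it is the list of trees
-- of the forest — both cases of the paper's definition.
opL : ℕ → List Tree → List Tree
opL k [] = []
opL zero (node cs ∷ ts) with unsnoc cs
... | nothing = node cs ∷ ts
... | just (cs' , v') = node cs' ∷ v' ∷ ts
opL (suc k) (node cs ∷ ts) =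
  if k <ᵇ sizeF cs
  then node (opL k cs) ∷ ts
  else node cs ∷ opL (k ∸ sizeF cs) ts

childrenAt : ℕ → List Tree → Maybe (List Tree)
childrenAt k [] = nothing
childrenAt zero (node cs ∷ ts) = just cs
childrenAt (suc k) (node cs ∷ ts) =
  if k <ᵇ sizeF cs then childrenAt k cs else childrenAt (k ∸ sizeF cs) ts

NonLeaf : Forest → ℕ → Set
NonLeaf F v = 1 ≤ v × v ≤ sizeF F × ∃ λ c → ∃ λ cs → childrenAt (v ∸ 1) F ≡ just (c ∷ cs)

_⟦_⟧ : Forest → ℕ → Forest
F ⟦ v ⟧ = opL (v ∸ 1) F

_⋖_ : {n : ℕ} → FOrd n → FOrd n → Set
F' ⋖ F = ∃ λ v → NonLeaf (proj₁ F) v × proj₁ F' ≡ (proj₁ F) ⟦ v ⟧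

_≤F_ : {n : ℕ} → FOrd n → FOrd n → Set
F' ≤F F = Star _⋖_ F' F

_<F_ : {n : ℕ} → FOrd n → FOrd n → Set
F' <F F = F' ≤F F × F' ≢ F

Covers : {n : ℕ} → FOrd n → FOrd n → Set
Covers {n} F' F = F' <F F × ¬ (∃ λ (G : FOrd n) → F' <F G × G <F F)

-- For a forest F let profile F list, in preorder, the number of proper
-- descendants of every vertex.  Operating on v preserves the preorder and
-- changes only the entry of v, which drops by the size of the detached
-- subtree: the ancestors of v keep v' among their descendants.  So ≤ lies
-- inside the pointwise order of profiles and every step lowers their sum,
-- which gives antisymmetry.  If F' = F[v] ≤ G ≤ H = F[w], the profile of F'
-- is below that of H, so both steps lower the same entry of profile F; thus
-- v = w, F' = H, and nothing lies strictly between F[v] and F.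
module Submission where

open import Defs
open import Data.Nat using (ℕ)
open import Data.Product using (_×_)
open import Function.Bundles using (_⇔_)
open import Relation.Binary.PropositionalEquality using (_≡_)
open import Relation.Binary.Structures using (IsPartialOrder)

open import Data.Bool using (true; false)
open import Data.Empty using (⊥-elim)
open import Data.List using (List; []; _∷_; _++_; _∷ʳ_; length; initLast; _∷ʳ′_)
open import Data.List.Properties using (++-assoc; length-++)
open import Data.List.Relation.Binary.Pointwise as Pointwise
  using (Pointwise; []; _∷_; Pointwise-length; foldr⁺)
open import Data.Maybe using (just)
open import Data.Nat using (zero; suc; _+_; _∸_; _≤_; _<_; _<ᵇ_; z≤n; s≤s)
open import Data.Nat.ListAction using (sum)
open import Data.Nat.Properties
  using (≤-refl; ≤-trans; <⇒≤; <⇒≱; ≮⇒≥; +-mono-≤; +-monoˡ-<; +-monoʳ-<;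
         +-assoc; m<m+n; m+[n∸m]≡n; ≡-irrelevant; <ᵇ-reflects-<)
open import Data.Product using (∃; _,_; proj₁)
open import Data.Product.Properties using (Σ-≡,≡→≡)
open import Data.Sum using (_⊎_; inj₁; inj₂)
open import Function.Base using (_∘_)
open import Function.Bundles using (mk⇔)
open import Level using (_⊔_)
open import Relation.Binary.Core using (Rel)
open import Relation.Binary.Construct.Closure.ReflexiveTransitive using (Star; ε; _◅_; _◅◅_)
import Relation.Binary.Construct.Closure.ReflexiveTransitive.Properties as Star
open import Relation.Binary.PropositionalEquality
  using (_≢_; refl; sym; trans; cong; cong₂; subst; module ≡-Reasoning)
open import Relation.Nullary using (¬_; ofⁿ)

infix 4 _≤*_

_≤*_ : Rel (List ℕ) _
_≤*_ = Pointwise _≤_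

sum-mono-≤* : ∀ {xs ys} → xs ≤* ys → sum xs ≤ sum ys
sum-mono-≤* = foldr⁺ +-mono-≤ ≤-refl

data LowerAt : ℕ → List ℕ → List ℕ → Set where
  here  : ∀ {x y xs} → x < y → LowerAt zero (x ∷ xs) (y ∷ xs)
  there : ∀ {k x xs ys} → LowerAt k xs ys → LowerAt (suc k) (x ∷ xs) (x ∷ ys)

LowerAt⇒≤* : ∀ {k xs ys} → LowerAt k xs ys → xs ≤* ys
LowerAt⇒≤* (here x<y) = <⇒≤ x<y ∷ Pointwise.refl ≤-refl
LowerAt⇒≤* (there p)  = ≤-refl ∷ LowerAt⇒≤* p

LowerAt⇒sum< : ∀ {k xs ys} → LowerAt k xs ys → sum xs < sum ys
LowerAt⇒sum< (here {xs = xs} x<y) = +-monoˡ-< (sum xs) x<y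
LowerAt⇒sum< (there {x = x} p)    = +-monoʳ-< x (LowerAt⇒sum< p)

LowerAt⇒≱* : ∀ {k xs ys} → LowerAt k xs ys → ¬ ys ≤* xs
LowerAt⇒≱* (here x<y) (y≤x ∷ _)   = <⇒≱ x<y y≤x
LowerAt⇒≱* (there p)  (_ ∷ ys≤xs) = LowerAt⇒≱* p ys≤xs

LowerAt-index-unique : ∀ {i j xs ys zs} →
                       LowerAt i xs zs → LowerAt j ys zs → xs ≤* ys → i ≡ j
LowerAt-index-unique (here _)  (here _)  _           = refl
LowerAt-index-unique (here _)  (there q) (_ ∷ xs≤ys) = ⊥-elim (LowerAt⇒≱* q xs≤ys)
LowerAt-index-unique (there _) (here q)  (x≤y ∷ _)   = ⊥-elim (<⇒≱ q x≤y)
LowerAt-index-unique (there p) (there q) (_ ∷ xs≤ys) = cong suc (LowerAt-index-unique p q xs≤ys)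

LowerAt-cast : ∀ {i j xs ys} → i ≡ j → LowerAt i xs ys → LowerAt j xs ys
LowerAt-cast refl p = p

LowerAt-++ʳ : ∀ {k xs ys} zs → LowerAt k xs ys → LowerAt k (xs ++ zs) (ys ++ zs)
LowerAt-++ʳ zs (here x<y) = here x<y
LowerAt-++ʳ zs (there p)  = there (LowerAt-++ʳ zs p)

LowerAt-++ˡ : ∀ {k xs ys} zs → LowerAt k xs ys → LowerAt (length zs + k) (zs ++ xs) (zs ++ ys)
LowerAt-++ˡ []       p = p
LowerAt-++ˡ (z ∷ zs) p = there (LowerAt-++ˡ zs p)

Star-unsnoc : ∀ {a ℓ} {A : Set a} {T : Rel A ℓ} {x y} →
              Star T x y → x ≡ y ⊎ ∃ λ z → Star T x z × T z y
Star-unsnoc ε = inj₁ refl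
Star-unsnoc (s ◅ r) with Star-unsnoc r
... | inj₁ refl          = inj₂ (_ , ε , s)
... | inj₂ (z , r′ , t) = inj₂ (z , s ◅ r′ , t)

module OneCoordinateDescent
  {a ℓ} {A : Set a} (_⋖_ : Rel A ℓ) (profile : A → List ℕ)
  (coordinate : ∀ {x y} → x ⋖ y → ℕ)
  (lowers : ∀ {x y} (s : x ⋖ y) → LowerAt (coordinate s) (profile x) (profile y))
  (coordinate-injective : ∀ {x y z} (s : x ⋖ z) (t : y ⋖ z) → coordinate s ≡ coordinate t → x ≡ y)
  where

  _≤⋆_ : Rel A (a ⊔ ℓ)
  _≤⋆_ = Star _⋖_

  _<⋆_ : Rel A (a ⊔ ℓ)
  x <⋆ y = x ≤⋆ y × x ≢ y

  Covered : Rel A (a ⊔ ℓ)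
  Covered x y = x <⋆ y × ¬ ∃ λ z → x <⋆ z × z <⋆ y

  profile-mono : ∀ {x y} → x ≤⋆ y → profile x ≤* profile y
  profile-mono ε       = Pointwise.refl ≤-refl
  profile-mono (s ◅ r) = Pointwise.transitive ≤-trans (LowerAt⇒≤* (lowers s)) (profile-mono r)

  step-irreflexive : ∀ {x y z} → x ⋖ y → y ≤⋆ z → x ≢ z
  step-irreflexive s r refl =
    <⇒≱ (LowerAt⇒sum< (lowers s)) (sum-mono-≤* (profile-mono r))

  antisym : ∀ {x y} → x ≤⋆ y → y ≤⋆ x → x ≡ y
  antisym ε       _ = refl
  antisym (s ◅ r) q = ⊥-elim (step-irreflexive s (r ◅◅ q) refl)

  isPartialOrder : IsPartialOrder _≡_ _≤⋆_
  isPartialOrder = record { isPreorder = Star.isPreorder _⋖_ ; antisym = antisym }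

  step-determined : ∀ {x y z} → x ⋖ z → y ⋖ z → x ≤⋆ y → x ≡ y
  step-determined s t x≤y = coordinate-injective s t
    (LowerAt-index-unique (lowers s) (lowers t) (profile-mono x≤y))

  ⋖⇒Covered : ∀ {x y} → x ⋖ y → Covered x y
  ⋖⇒Covered {x} {y} s = (s ◅ ε , step-irreflexive s ε) , nothing-between
    where
    nothing-between : ¬ ∃ λ z → x <⋆ z × z <⋆ y
    nothing-between (z , (x≤z , x≢z) , (z≤y , z≢y)) with Star-unsnoc z≤y
    ... | inj₁ z≡y             = z≢y z≡y
    ... | inj₂ (w , z≤w , t) with step-determined s t (x≤z ◅◅ z≤w)
    ...   | refl = x≢z (antisym x≤z z≤w)

  Covered⇒⋖ : ∀ {x y} → Covered x y → x ⋖ y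
  Covered⇒⋖ ((x≤y , x≢y) , nothing-between) with Star-unsnoc x≤y
  ... | inj₁ x≡y            = ⊥-elim (x≢y x≡y)
  ... | inj₂ (z , ε , t)     = t
  ... | inj₂ (z , s ◅ r , t) =
    ⊥-elim (nothing-between (z , (s ◅ r , step-irreflexive s r) , (t ◅ ε , step-irreflexive t ε)))

  ⋖⇔Covered : ∀ {x y} → (x ⋖ y) ⇔ Covered x y
  ⋖⇔Covered = mk⇔ ⋖⇒Covered Covered⇒⋖

descendants : Forest → List ℕ
descendants []             = []
descendants (node cs ∷ ts) = sizeF cs ∷ descendants cs ++ descendants ts

descendants-++ : ∀ xs ys → descendants (xs ++ ys) ≡ descendants xs ++ descendants ys
descendants-++ []             ys = refl
descendants-++ (node cs ∷ xs) ys = cong (sizeF cs ∷_) (begin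
  descendants cs ++ descendants (xs ++ ys)              ≡⟨ cong (descendants cs ++_) (descendants-++ xs ys) ⟩
  descendants cs ++ descendants xs ++ descendants ys    ≡⟨ ++-assoc (descendants cs) _ _ ⟨
  (descendants cs ++ descendants xs) ++ descendants ys  ∎)
  where open ≡-Reasoning

length-descendants : ∀ F → length (descendants F) ≡ sizeF F
length-descendants []             = refl
length-descendants (node cs ∷ ts) = cong suc (begin
  length (descendants cs ++ descendants ts)           ≡⟨ length-++ (descendants cs) ⟩
  length (descendants cs) + length (descendants ts)   ≡⟨ cong₂ _+_ (length-descendants cs) (length-descendants ts) ⟩
  sizeF cs + sizeF ts                                 ∎)
  where open ≡-Reasoning

sizeF-++ : ∀ xs ys → sizeF (xs ++ ys) ≡ sizeF xs + sizeF ys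
sizeF-++ []       ys = refl
sizeF-++ (t ∷ xs) ys = trans (cong (sizeT t +_) (sizeF-++ xs ys)) (sym (+-assoc (sizeT t) _ _))

sizeF-<-∷ʳ : ∀ cs t → sizeF cs < sizeF (cs ∷ʳ t)
sizeF-<-∷ʳ cs (node ds) = subst (sizeF cs <_) (sym (sizeF-++ cs (node ds ∷ []))) (m<m+n (sizeF cs) (s≤s z≤n))

unsnoc-∷ʳ : ∀ cs t → unsnoc (cs ∷ʳ t) ≡ just (cs , t)
unsnoc-∷ʳ []       t = refl
unsnoc-∷ʳ (c ∷ cs) t rewrite unsnoc-∷ʳ cs t = refl

opL-root : ∀ cs t ts → opL zero (node (cs ∷ʳ t) ∷ ts) ≡ node cs ∷ t ∷ ts
opL-root cs t ts rewrite unsnoc-∷ʳ cs t = refl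

descendants-detach-last : ∀ cs t ts →
  LowerAt zero (descendants (node cs ∷ t ∷ ts)) (descendants (node (cs ∷ʳ t) ∷ ts))
descendants-detach-last cs t ts =
  subst (LowerAt zero (descendants (node cs ∷ t ∷ ts)) ∘ (sizeF (cs ∷ʳ t) ∷_)) same-tail (here (sizeF-<-∷ʳ cs t))
  where
  same-tail : descendants cs ++ descendants (t ∷ ts) ≡ descendants (cs ∷ʳ t) ++ descendants ts
  same-tail = begin
    descendants cs ++ descendants (t ∷ ts)   ≡⟨ descendants-++ cs (t ∷ ts) ⟨
    descendants (cs ++ t ∷ ts)               ≡⟨ cong descendants (++-assoc cs (t ∷ []) ts) ⟨
    descendants ((cs ∷ʳ t) ++ ts)            ≡⟨ descendants-++ (cs ∷ʳ t) ts ⟩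
    descendants (cs ∷ʳ t) ++ descendants ts  ∎
    where open ≡-Reasoning

descendants-≤*⇒sizeF-≡ : ∀ {F G} → descendants F ≤* descendants G → sizeF F ≡ sizeF G
descendants-≤*⇒sizeF-≡ {F} {G} F≤G =
  trans (sym (length-descendants F)) (trans (Pointwise-length F≤G) (length-descendants G))

LowerAt-children : ∀ {k cs′ cs} ts → LowerAt k (descendants cs′) (descendants cs) →
  LowerAt (suc k) (descendants (node cs′ ∷ ts)) (descendants (node cs ∷ ts))
LowerAt-children ts p rewrite descendants-≤*⇒sizeF-≡ (LowerAt⇒≤* p) = there (LowerAt-++ʳ (descendants ts) p)

LowerAt-siblings : ∀ {k ts′ ts} cs → sizeF cs ≤ k → LowerAt (k ∸ sizeF cs) (descendants ts′) (descendants ts) →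
  LowerAt (suc k) (descendants (node cs ∷ ts′)) (descendants (node cs ∷ ts))
LowerAt-siblings {k} cs cs≤k p = there (LowerAt-cast index≡k (LowerAt-++ˡ (descendants cs) p))
  where
  index≡k : length (descendants cs) + (k ∸ sizeF cs) ≡ k
  index≡k = trans (cong (_+ (k ∸ sizeF cs)) (length-descendants cs)) (m+[n∸m]≡n cs≤k)

descendants-opL : ∀ k F {c cs} → childrenAt k F ≡ just (c ∷ cs) →
  LowerAt k (descendants (opL k F)) (descendants F)
descendants-opL k [] ()
descendants-opL zero (node ds ∷ ts) hasChild with initLast ds
descendants-opL zero (node .[] ∷ ts) () | []
descendants-opL zero (node .(cs ∷ʳ t) ∷ ts) _ | cs ∷ʳ′ t
  rewrite opL-root cs t ts = descendants-detach-last cs t ts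
descendants-opL (suc k) (node ds ∷ ts) hasChild with k <ᵇ sizeF ds | <ᵇ-reflects-< k (sizeF ds)
... | true  | _       = LowerAt-children ts (descendants-opL k ds hasChild)
... | false | ofⁿ k≮s = LowerAt-siblings ds (≮⇒≥ k≮s) (descendants-opL (k ∸ sizeF ds) ts hasChild)

module _ {n : ℕ} where

  profile : FOrd n → List ℕ
  profile = descendants ∘ proj₁

  operated-index : {F′ F : FOrd n} → F′ ⋖ F → ℕ
  operated-index (v , _) = v ∸ 1

  ⋖-lowers-profile : {F′ F : FOrd n} (s : F′ ⋖ F) →
                     LowerAt (operated-index {F′} {F} s) (profile F′) (profile F)
  ⋖-lowers-profile {F = F , _} (v , (_ , _ , _ , _ , hasChild) , refl) = descendants-opL (v ∸ 1) F hasChild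

  operated-index-injective : {F′ G F : FOrd n} (s : F′ ⋖ F) (t : G ⋖ F) →
                             operated-index {F′} {F} s ≡ operated-index {G} {F} t → F′ ≡ G
  operated-index-injective {F = F , _} (v , _ , refl) (w , _ , refl) same-index =
    Σ-≡,≡→≡ (cong (λ k → opL k F) same-index , ≡-irrelevant _ _)

theorem4p6 : (n : ℕ) → IsPartialOrder (_≡_ {A = FOrd n}) (_≤F_ {n}) × ((F' F : FOrd n) → (F' ⋖ F) ⇔ Covers F' F)
theorem4p6 n = isPartialOrder , λ _ _ → ⋖⇔Covered
  where
  -- _⋖_ unfolds to an ∃-type, so the forests at its ends cannot be inferred.
  open OneCoordinateDescent (_⋖_ {n}) profile
    (λ {F′ F} → operated-index {F′ = F′} {F})
    (λ {F′ F} → ⋖-lowers-profile {F′ = F′} {F})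
    (λ {F′ G F} → operated-index-injective {F′ = F′} {G} {F})
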